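{- Let $p$ and $q$ be prime numbers with $p<q$, and let $t,m\ge 2$. Then $$\frac{\phi(C_{p^m})}{\phi(C_{p^{m-1}}\times C_p)}<\frac{\phi(C_{q^t})}{\phi(C_{q^{t-1}}\times C_q)}.$$
   Context: $C_k$ is the cyclic group of order $k$, $o(g)$ the order of $g$, $\phi$ applied to an integer is Euler's totient function, and for a finite group $G$, $\phi(G)=\sum_{g\in G}\phi(o(g))$. -}

module Defs where

open import Data.Nat using (ℕ; zero; suc; _+_; _*_)
open import Data.Nat.GCD using (gcd)
open import Data.Nat.Divisibility using (_∣?_)
open import Data.Bool using (Bool; true; false; if_then_else_; _∧_)
open import Data.List using (List; []; _∷_; map; concatMap; upTo; length; filter)
open import Relation.Nullary.Decidable using (⌊_⌋)
open import Data.Nat using (_≟_)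
open import Data.Nat.ListAction using (sum; product)

totient : ℕ → ℕ
totient n = length (filter (λ k → gcd (suc k) n ≟ 1) (upTo n))

-- A finite abelian group  C_{k₁} × … × C_{kᵣ}  is described by its list of moduli.
-- Its elements are tuples (a₁,…,aᵣ) with 0 ≤ aᵢ < kᵢ, group operation componentwise
-- addition mod kᵢ, identity (0,…,0).
Moduli : Set
Moduli = List ℕ

elements : Moduli → List (List ℕ)
elements []       = [] ∷ []
elements (k ∷ ks) = concatMap (λ a → map (a ∷_) (elements ks)) (upTo k)

card : Moduli → ℕ
card = product

killedBy : Moduli → List ℕ → ℕ → Bool
killedBy []       _        n = true
killedBy (k ∷ ks) []       n = true
killedBy (k ∷ ks) (a ∷ as) n = ⌊ k ∣? (n * a) ⌋ ∧ killedBy ks as n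

-- first i in [start, start + fuel) satisfying P (0 if none)
search : ℕ → ℕ → (ℕ → Bool) → ℕ
search zero     i P = 0
search (suc f) i P = if P i then i else search f (suc i) P

-- order of g: least n ≥ 1 with n • g = identity (searched in 1..|G|, which suffices
-- since the order of an element divides |G|)
order : Moduli → List ℕ → ℕ
order ks g = search (card ks) 1 (killedBy ks g)

phiG : Moduli → ℕ
phiG ks = sum (map (λ g → totient (order ks g)) (elements ks))

C : ℕ → Moduli
C k = k ∷ []

_×C_ : Moduli → Moduli → Moduli
[] ×C ys = ys
(x ∷ xs) ×C ys = x ∷ (xs ×C ys)

-- In C_{p^(n+1)} × H with |H| dividing p, the elements whose first coordinate is a
-- multiple of p correspond, order for order, to the elements of C_{p^n} × H, and all
-- the other p^n (p-1) |H| elements have order p^(n+1). Hence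
--   φ(C_{p^(n+1)} × H) = φ(C_{p^n} × H) + |H| φ(p^(n+1))²,
-- and for Φ n = φ(C_{p^n}), Ψ n = φ(C_{p^n} × C_p) these recurrences give
--   p Ψ n = Φ (n+1) + (p-1) Φ 1.
-- From this identity, Φ (n+1) < p Ψ n and (p-1) Ψ (n+1) < Φ (n+2); the first for p and
-- the second for q, joined by p ≤ q - 1, give the claimed inequality of cross products.
module Submission where

open import Defs
open import Data.Bool using (Bool; true; false; _∧_; if_then_else_)
open import Data.List using (List; []; _∷_; _++_; map; concatMap; upTo; applyUpTo; filter; length)
open import Data.List.Properties using (map-++; map-cong; map-∘)
open import Data.Nat
open import Data.Nat.Coprimality using (Coprime; coprime-divisor; coprime⇒gcd≡1; gcd≡1⇒coprime)
import Data.Nat.Coprimality as Coprimality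
open import Data.Nat.Divisibility
open import Data.Nat.GCD using (gcd)
open import Data.Nat.ListAction using (sum)
open import Data.Nat.ListAction.Properties using (sum-++)
open import Data.Nat.Primality using (Prime; prime⇒irreducible; prime⇒nonTrivial)
open import Data.Nat.Properties
open import Data.Nat.Tactic.RingSolver using (solve-∀)
open import Data.Product using (_×_; _,_)
open import Data.Sum using (inj₁; inj₂)
open import Function using (_∘_; id; const; mk⇔)
open import Level using (0ℓ)
open import Relation.Binary.Definitions using (tri<; tri≈; tri>)
open import Relation.Binary.PropositionalEquality
open import Relation.Nullary using (¬_; Dec; does; contradiction)
open import Relation.Nullary.Decidable using (isYes; isYes≗does; dec-true; dec-false; does-⇔)
open import Relation.Unary using (Pred; Decidable)

∑< : ℕ → (ℕ → ℕ) → ℕ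
∑< zero    f = 0
∑< (suc n) f = f 0 + ∑< n (f ∘ suc)

∑<-cong : ∀ n {f g : ℕ → ℕ} → (∀ i → i < n → f i ≡ g i) → ∑< n f ≡ ∑< n g
∑<-cong zero    _   = refl
∑<-cong (suc n) f≡g = cong₂ _+_ (f≡g 0 z<s) (∑<-cong n (λ i i<n → f≡g (suc i) (s<s i<n)))

∑<-const : ∀ n c → ∑< n (const c) ≡ n * c
∑<-const zero    c = refl
∑<-const (suc n) c = cong (c +_) (∑<-const n c)

∑<-distrib-+ : ∀ n (f g : ℕ → ℕ) → ∑< n (λ i → f i + g i) ≡ ∑< n f + ∑< n g
∑<-distrib-+ zero    f g = refl
∑<-distrib-+ (suc n) f g =
  trans (cong (f 0 + g 0 +_) (∑<-distrib-+ n (f ∘ suc) (g ∘ suc))) (interchange (f 0) (g 0) _ _)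
  where
  interchange : ∀ a b c d → (a + b) + (c + d) ≡ (a + c) + (b + d)
  interchange = solve-∀

∑<-+ : ∀ m n f → ∑< (m + n) f ≡ ∑< m f + ∑< n (λ i → f (m + i))
∑<-+ zero    n f = refl
∑<-+ (suc m) n f = trans (cong (f 0 +_) (∑<-+ m n (f ∘ suc))) (sym (+-assoc (f 0) _ _))

∑<-* : ∀ m n f → ∑< (m * n) f ≡ ∑< m (λ b → ∑< n (λ r → f (b * n + r)))
∑<-* zero    n f = refl
∑<-* (suc m) n f = trans (∑<-+ n (m * n) f) (cong (∑< n f +_) (trans (∑<-* m n (λ i → f (n + i)))
  (∑<-cong m (λ b _ → ∑<-cong n (λ r _ → cong f (sym (+-assoc n (b * n) r)))))))

∑<-last : ∀ n f → ∑< (suc n) f ≡ ∑< n f + f n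
∑<-last zero    f = +-comm (f 0) 0
∑<-last (suc n) f = trans (cong (f 0 +_) (∑<-last n (f ∘ suc))) (sym (+-assoc (f 0) _ _))

sum-map-applyUpTo : ∀ (f g : ℕ → ℕ) n → sum (map f (applyUpTo g n)) ≡ ∑< n (f ∘ g)
sum-map-applyUpTo f g zero    = refl
sum-map-applyUpTo f g (suc n) = cong (f (g 0) +_) (sum-map-applyUpTo f (g ∘ suc) n)

sum-map-upTo : ∀ (f : ℕ → ℕ) n → sum (map f (upTo n)) ≡ ∑< n f
sum-map-upTo f = sum-map-applyUpTo f id

sum-map-concatMap : ∀ {A B : Set} (F : B → ℕ) (h : A → List B) xs →
  sum (map F (concatMap h xs)) ≡ sum (map (λ x → sum (map F (h x))) xs)
sum-map-concatMap F h []       = refl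
sum-map-concatMap F h (x ∷ xs) = begin
  sum (map F (h x ++ concatMap h xs))              ≡⟨ cong sum (map-++ F (h x) _) ⟩
  sum (map F (h x) ++ map F (concatMap h xs))      ≡⟨ sum-++ (map F (h x)) _ ⟩
  sum (map F (h x)) + sum (map F (concatMap h xs)) ≡⟨ cong (_ +_) (sum-map-concatMap F h xs) ⟩
  sum (map F (h x)) + sum (map (λ x → sum (map F (h x))) xs) ∎
  where open ≡-Reasoning

length-filter≡sum : ∀ {P : Pred ℕ 0ℓ} (P? : Decidable P) xs →
  length (filter P? xs) ≡ sum (map (λ x → if does (P? x) then 1 else 0) xs)
length-filter≡sum P? []       = refl
length-filter≡sum P? (x ∷ xs) with does (P? x)
... | true  = cong suc (length-filter≡sum P? xs)
... | false = length-filter≡sum P? xs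

sum-elements-∷ : ∀ k ks (F : List ℕ → ℕ) →
  sum (map F (elements (k ∷ ks))) ≡ ∑< k (λ a → sum (map (F ∘ (a ∷_)) (elements ks)))
sum-elements-∷ k ks F = begin
  sum (map F (concatMap (λ a → map (a ∷_) (elements ks)) (upTo k)))
    ≡⟨ sum-map-concatMap F _ (upTo k) ⟩
  sum (map (λ a → sum (map F (map (a ∷_) (elements ks)))) (upTo k))
    ≡⟨ sum-map-upTo _ k ⟩
  ∑< k (λ a → sum (map F (map (a ∷_) (elements ks))))
    ≡⟨ ∑<-cong k (λ a _ → cong sum (sym (map-∘ (elements ks)))) ⟩
  ∑< k (λ a → sum (map (F ∘ (a ∷_)) (elements ks))) ∎
  where open ≡-Reasoning

sum-const-elements : ∀ ks c → sum (map (const c) (elements ks)) ≡ card ks * c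
sum-const-elements []       c = refl
sum-const-elements (k ∷ ks) c = begin
  sum (map (const c) (elements (k ∷ ks)))          ≡⟨ sum-elements-∷ k ks (const c) ⟩
  ∑< k (const (sum (map (const c) (elements ks)))) ≡⟨ ∑<-const k _ ⟩
  k * sum (map (const c) (elements ks))            ≡⟨ cong (k *_) (sum-const-elements ks c) ⟩
  k * (card ks * c)                                ≡⟨ *-assoc k (card ks) c ⟨
  k * card ks * c ∎
  where open ≡-Reasoning

IsLeastFrom : ℕ → (ℕ → Bool) → ℕ → Set
IsLeastFrom i P n = i ≤ n × P n ≡ true × (∀ k → i ≤ k → k < n → P k ≡ false)

isLeastFrom-pred : ∀ {i P n} → P i ≡ false → IsLeastFrom (suc i) P n → IsLeastFrom i P n
isLeastFrom-pred {i} {P} {n} Pi (i<n , Pn , below) = <⇒≤ i<n , Pn , earlier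
  where
  earlier : ∀ k → i ≤ k → k < n → P k ≡ false
  earlier k i≤k k<n with m≤n⇒m<n∨m≡n i≤k
  ... | inj₁ i<k  = below k i<k k<n
  ... | inj₂ refl = Pi

search-isLeastFrom : ∀ fuel i P j → i ≤ j → j < i + fuel → P j ≡ true →
  IsLeastFrom i P (search fuel i P)
search-isLeastFrom zero i P j i≤j j<i+0 _ =
  contradiction i≤j (<⇒≱ (subst (j <_) (+-identityʳ i) j<i+0))
search-isLeastFrom (suc fuel) i P j i≤j j<i+1+fuel Pj with P i in Pi
... | true  = ≤-refl , Pi , λ k i≤k k<i → contradiction i≤k (<⇒≱ k<i)
... | false = isLeastFrom-pred Pi
  (search-isLeastFrom fuel (suc i) P j (≤∧≢⇒< i≤j i≢j) (subst (j <_) (+-suc i fuel) j<i+1+fuel) Pj)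
  where
  i≢j : i ≢ j
  i≢j refl = contradiction (trans (sym Pj) Pi) λ ()

isLeastFrom-unique : ∀ {i P m n} → IsLeastFrom i P m → IsLeastFrom i P n → m ≡ n
isLeastFrom-unique {m = m} {n} (i≤m , Pm , belowm) (i≤n , Pn , belown) with <-cmp m n
... | tri< m<n _ _ = contradiction (trans (sym Pm) (belown m i≤m m<n)) λ ()
... | tri≈ _ m≡n _ = m≡n
... | tri> _ _ n<m = contradiction (trans (sym Pn) (belowm n i≤n n<m)) λ ()

isLeastFrom-cong : ∀ {i P Q n} → (∀ k → P k ≡ Q k) → IsLeastFrom i P n → IsLeastFrom i Q n
isLeastFrom-cong P≗Q (i≤n , Pn , below) =
  i≤n , trans (sym (P≗Q _)) Pn , λ k i≤k k<n → trans (sym (P≗Q k)) (below k i≤k k<n)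

isYes-true : ∀ {A : Set} (a? : Dec A) → A → isYes a? ≡ true
isYes-true a? a = trans (isYes≗does a?) (dec-true a? a)

isYes-false : ∀ {A : Set} (a? : Dec A) → ¬ A → isYes a? ≡ false
isYes-false a? ¬a = trans (isYes≗does a?) (dec-false a? ¬a)

isYes-⇔ : ∀ {A B : Set} (a? : Dec A) (b? : Dec B) → (A → B) → (B → A) → isYes a? ≡ isYes b?
isYes-⇔ a? b? A→B B→A =
  trans (isYes≗does a?) (trans (does-⇔ (mk⇔ A→B B→A) a? b?) (sym (isYes≗does b?)))

card∣⇒killedBy : ∀ ks g n → card ks ∣ n → killedBy ks g n ≡ true
card∣⇒killedBy []       g        n _ = refl
card∣⇒killedBy (k ∷ ks) []       n _ = refl
card∣⇒killedBy (k ∷ ks) (a ∷ as) n kks∣n =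
  cong₂ _∧_ (isYes-true (k ∣? (n * a)) (∣-trans (∣-trans (m∣m*n (card ks)) kks∣n) (m∣m*n a)))
            (card∣⇒killedBy ks as n (∣-trans (n∣m*n k) kks∣n))

order-isLeastFrom : ∀ ks g → 1 ≤ card ks → IsLeastFrom 1 (killedBy ks g) (order ks g)
order-isLeastFrom ks g card>0 =
  search-isLeastFrom (card ks) 1 (killedBy ks g) (card ks) card>0 ≤-refl
    (card∣⇒killedBy ks g (card ks) ∣-refl)

isLeastFrom⇒order≡ : ∀ {ks g n} → 1 ≤ card ks → IsLeastFrom 1 (killedBy ks g) n → order ks g ≡ n
isLeastFrom⇒order≡ {ks} {g} card>0 = isLeastFrom-unique (order-isLeastFrom ks g card>0)

order-cong : ∀ {ks ks′ g g′} → 1 ≤ card ks → 1 ≤ card ks′ →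
  (∀ k → killedBy ks g k ≡ killedBy ks′ g′ k) → order ks g ≡ order ks′ g′
order-cong {ks} {ks′} {g} {g′} card>0 card′>0 same =
  isLeastFrom⇒order≡ {ks} {g} card>0
    (isLeastFrom-cong (λ k → sym (same k)) (order-isLeastFrom ks′ g′ card′>0))

phiG-1∷ : ∀ ks → 1 ≤ card ks → phiG (1 ∷ ks) ≡ phiG ks
phiG-1∷ ks card>0 = begin
  phiG (1 ∷ ks)                                          ≡⟨ sum-elements-∷ 1 ks _ ⟩
  sum (map (λ g → totient (order (1 ∷ ks) (0 ∷ g))) E) + 0 ≡⟨ +-identityʳ _ ⟩
  sum (map (λ g → totient (order (1 ∷ ks) (0 ∷ g))) E)   ≡⟨ cong sum (map-cong same-order E) ⟩
  phiG ks ∎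
  where
  open ≡-Reasoning
  E = elements ks
  card1>0 : 1 ≤ card (1 ∷ ks)
  card1>0 = subst (1 ≤_) (sym (*-identityˡ (card ks))) card>0
  same-order : ∀ g → totient (order (1 ∷ ks) (0 ∷ g)) ≡ totient (order ks g)
  same-order g = cong totient (order-cong {1 ∷ ks} {ks} {0 ∷ g} card1>0 card>0
    λ k → cong (_∧ killedBy ks g k) (isYes-true (1 ∣? (k * 0)) (1∣ _)))

module _ {p : ℕ} (p-prime : Prime p) where

  ∤⇒coprime : ∀ {a} → p ∤ a → Coprime p a
  ∤⇒coprime p∤a {d} (d∣p , d∣a) with prime⇒irreducible p-prime d∣p
  ... | inj₁ d≡1  = d≡1
  ... | inj₂ refl = contradiction d∣a p∤a

  ∤⇒coprime-^ : ∀ {a} → p ∤ a → ∀ j → Coprime (p ^ j) a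
  ∤⇒coprime-^ p∤a zero    (d∣1 , _)     = ∣1⇒≡1 d∣1
  ∤⇒coprime-^ p∤a (suc j) {d} (d∣p^1+j , d∣a) =
    ∤⇒coprime-^ p∤a j (coprime-divisor d-coprime-p d∣p^1+j , d∣a)
    where
    d-coprime-p : Coprime d p
    d-coprime-p (e∣d , e∣p) = ∤⇒coprime p∤a (e∣p , ∣-trans e∣d d∣a)

  ^-∣-cancelʳ : ∀ {a} → p ∤ a → ∀ j k → p ^ j ∣ k * a → p ^ j ∣ k
  ^-∣-cancelʳ {a} p∤a j k p^j∣k*a =
    coprime-divisor (∤⇒coprime-^ p∤a j) (subst (p ^ j ∣_) (*-comm k a) p^j∣k*a)

-- For a prime p = suc p′: φₚ p′ n = φ(p^(n+1)), ΦC p′ n = φ(C_{p^n}) and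
-- ΦC×C p′ n = φ(C_{p^n} × C_p).
φₚ : ℕ → ℕ → ℕ
φₚ p′ n = suc p′ ^ n * p′

ΦC : ℕ → ℕ → ℕ
ΦC p′ zero    = 1
ΦC p′ (suc n) = ΦC p′ n + φₚ p′ n * φₚ p′ n

ΦC×C : ℕ → ℕ → ℕ
ΦC×C p′ zero    = ΦC p′ 1
ΦC×C p′ (suc n) = ΦC×C p′ n + suc p′ * (φₚ p′ n * φₚ p′ n)

*-ΦC×C : ∀ p′ n → suc p′ * ΦC×C p′ n ≡ ΦC p′ (suc n) + p′ * ΦC p′ 1
*-ΦC×C p′ zero    = refl
*-ΦC×C p′ (suc n) = begin
  p * (ΦC×C p′ n + p * u²)                  ≡⟨ *-distribˡ-+ p (ΦC×C p′ n) _ ⟩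
  p * ΦC×C p′ n + p * (p * u²)              ≡⟨ cong (_+ p * (p * u²)) (*-ΦC×C p′ n) ⟩
  ΦC p′ (suc n) + p′ * ΦC p′ 1 + p * (p * u²) ≡⟨ shuffle (ΦC p′ (suc n)) (p′ * ΦC p′ 1) p′ (p ^ n) ⟩
  ΦC p′ (suc (suc n)) + p′ * ΦC p′ 1 ∎
  where
  open ≡-Reasoning
  p = suc p′
  u² = φₚ p′ n * φₚ p′ n
  shuffle : ∀ a c k P → a + c + suc k * (suc k * ((P * k) * (P * k)))
                      ≡ a + ((suc k * P) * k) * ((suc k * P) * k) + c
  shuffle = solve-∀

ΦC<*ΦC×C : ∀ p′ n → 1 ≤ p′ → ΦC p′ (suc n) < suc p′ * ΦC×C p′ n
ΦC<*ΦC×C p′ n 1≤p′ =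
  subst (ΦC p′ (suc n) <_) (sym (*-ΦC×C p′ n)) (m<m+n _ (*-mono-≤ 1≤p′ (s≤s z≤n)))

*ΦC1<ΦC×C : ∀ p′ n → p′ * ΦC p′ 1 < ΦC×C p′ (suc n)
*ΦC1<ΦC×C zero    zero    = s≤s z≤n
*ΦC1<ΦC×C (suc k) zero    = subst (suc k * ΦC (suc k) 1 <_) (sym (expand k)) (s≤s (m≤m+n _ _))
  where
  -- ΦC×C p′ 1 - p′ ΦC p′ 1 = 1 + p′ (2p′ - 1), written with k = p′ - 1 to avoid subtraction.
  expand : ∀ k → (1 + (1 * suc k) * (1 * suc k)) + suc (suc k) * ((1 * suc k) * (1 * suc k))
               ≡ suc (suc k * (1 + (1 * suc k) * (1 * suc k)) + suc k * (k + suc k))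
  expand = solve-∀
*ΦC1<ΦC×C p′ (suc n) = <-≤-trans (*ΦC1<ΦC×C p′ n) (m≤m+n _ _)

*ΦC×C<ΦC : ∀ p′ s → p′ * ΦC×C p′ (suc s) < ΦC p′ (suc (suc s))
*ΦC×C<ΦC p′ s = +-cancelʳ-< (p′ * ΦC p′ 1) _ _ (begin-strict
  p′ * ΦC×C p′ (suc s) + p′ * ΦC p′ 1    <⟨ +-monoʳ-< (p′ * ΦC×C p′ (suc s)) (*ΦC1<ΦC×C p′ s) ⟩
  p′ * ΦC×C p′ (suc s) + ΦC×C p′ (suc s) ≡⟨ +-comm (p′ * ΦC×C p′ (suc s)) _ ⟩
  suc p′ * ΦC×C p′ (suc s)               ≡⟨ *-ΦC×C p′ (suc s) ⟩
  ΦC p′ (suc (suc s)) + p′ * ΦC p′ 1 ∎)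
  where open ≤-Reasoning

ΦC-ΦC×C-cross-< : ∀ {p′ q′} n s → 1 ≤ p′ → p′ < q′ →
  ΦC p′ (suc n) * ΦC×C q′ (suc s) < ΦC q′ (suc (suc s)) * ΦC×C p′ n
ΦC-ΦC×C-cross-< {p′} {q′} n s 1≤p′ p′<q′ = begin-strict
  ΦC p′ (suc n) * Ψq               <⟨ *-monoˡ-< Ψq {{>-nonZero Ψq>0}} (ΦC<*ΦC×C p′ n 1≤p′) ⟩
  (suc p′ * Ψp) * Ψq               ≤⟨ *-monoˡ-≤ Ψq (*-monoˡ-≤ Ψp p′<q′) ⟩
  (q′ * Ψp) * Ψq                   ≡⟨ swap q′ Ψp Ψq ⟩
  (q′ * Ψq) * Ψp                   ≤⟨ *-monoˡ-≤ Ψp (<⇒≤ (*ΦC×C<ΦC q′ s)) ⟩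
  ΦC q′ (suc (suc s)) * Ψp ∎
  where
  open ≤-Reasoning
  Ψp = ΦC×C p′ n
  Ψq = ΦC×C q′ (suc s)
  Ψq>0 : Ψq > 0
  Ψq>0 = <-≤-trans (s≤s z≤n) (*ΦC1<ΦC×C q′ s)
  swap : ∀ a b c → (a * b) * c ≡ (a * c) * b
  swap = solve-∀

module PrimePower {p′ : ℕ} (p-prime : Prime (suc p′)) where

  private
    p : ℕ
    p = suc p′

  ∤-+suc : ∀ b r → r < p′ → p ∤ b * p + suc r
  ∤-+suc b r r<p′ p∣ = <⇒≱ (s<s r<p′) (∣⇒≤ (∣m+n∣m⇒∣n p∣ (n∣m*n b)))

  totient-^-suc : ∀ n → totient (p ^ suc n) ≡ φₚ p′ n
  totient-^-suc n = begin
    totient N                                      ≡⟨ length-filter≡sum (λ k → gcd (suc k) N ≟ 1) (upTo N) ⟩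
    sum (map χ (upTo N))                           ≡⟨ sum-map-upTo χ N ⟩
    ∑< (p * p ^ n) χ                               ≡⟨ cong (λ z → ∑< z χ) (*-comm p (p ^ n)) ⟩
    ∑< (p ^ n * p) χ                               ≡⟨ ∑<-* (p ^ n) p χ ⟩
    ∑< (p ^ n) (λ b → ∑< p (λ r → χ (b * p + r)))  ≡⟨ ∑<-cong (p ^ n) (λ b _ → block b) ⟩
    ∑< (p ^ n) (const p′)                          ≡⟨ ∑<-const (p ^ n) p′ ⟩
    p ^ n * p′ ∎
    where
    open ≡-Reasoning
    N = p ^ suc n
    χ : ℕ → ℕ
    χ k = if does (gcd (suc k) N ≟ 1) then 1 else 0
    unit : ∀ b r → r < p′ → χ (b * p + r) ≡ 1
    unit b r r<p′ = cong (if_then 1 else 0) (dec-true (gcd (suc (b * p + r)) N ≟ 1)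
      (coprime⇒gcd≡1 (Coprimality.sym (∤⇒coprime-^ p-prime p∤ (suc n)))))
      where
      p∤ : p ∤ suc (b * p + r)
      p∤ = subst (p ∤_) (+-suc (b * p) r) (∤-+suc b r r<p′)
    nonunit : ∀ b → χ (b * p + p′) ≡ 0
    nonunit b = cong (if_then 1 else 0) (dec-false (gcd (suc (b * p + p′)) N ≟ 1)
      λ gcd≡1 → nonTrivial⇒≢1 {{prime⇒nonTrivial p-prime}} (gcd≡1⇒coprime gcd≡1 (p∣ , m∣m*n (p ^ n))))
      where
      p∣ : p ∣ suc (b * p + p′)
      p∣ = divides (suc b) (cong suc (+-comm (b * p) p′))
    block : ∀ b → ∑< p (λ r → χ (b * p + r)) ≡ p′
    block b = begin
      ∑< p (λ r → χ (b * p + r))                  ≡⟨ ∑<-last p′ _ ⟩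
      ∑< p′ (λ r → χ (b * p + r)) + χ (b * p + p′) ≡⟨ cong₂ _+_ (∑<-cong p′ (unit b)) (nonunit b) ⟩
      ∑< p′ (const 1) + 0                        ≡⟨ +-identityʳ _ ⟩
      ∑< p′ (const 1)                            ≡⟨ ∑<-const p′ 1 ⟩
      p′ * 1                                     ≡⟨ *-identityʳ p′ ⟩
      p′ ∎

  module _ (rest : Moduli) (rest∣p : card rest ∣ p) where

    private
      card>0 : ∀ n → 1 ≤ card (p ^ n ∷ rest)
      card>0 n = *-mono-≤ (m^n>0 p n) (n≢0⇒n>0 λ card≡0 → 1+n≢0 (0∣⇒≡0 (subst (_∣ p) card≡0 rest∣p)))

    order-∷-* : ∀ n b g → order (p ^ suc n ∷ rest) (b * p ∷ g) ≡ order (p ^ n ∷ rest) (b ∷ g)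
    order-∷-* n b g = order-cong {p ^ suc n ∷ rest} {p ^ n ∷ rest} (card>0 (suc n)) (card>0 n) λ k →
      cong (_∧ killedBy rest g k) (isYes-⇔ (p ^ suc n ∣? k * (b * p)) (p ^ n ∣? k * b)
        (λ ∣kbp → *-cancelˡ-∣ p (subst (p ^ suc n ∣_) (reorder k b) ∣kbp))
        (λ ∣kb → subst (p ^ suc n ∣_) (sym (reorder k b)) (*-monoʳ-∣ p ∣kb)))
      where
      reorder : ∀ k b → k * (b * p) ≡ p * (k * b)
      reorder k b = trans (sym (*-assoc k b p)) (*-comm (k * b) p)

    order-∷-∤ : ∀ n a g → p ∤ a → order (p ^ suc n ∷ rest) (a ∷ g) ≡ p ^ suc n
    order-∷-∤ n a g p∤a =
      isLeastFrom⇒order≡ {p ^ suc n ∷ rest} (card>0 (suc n)) (m^n>0 p (suc n) , kills , below)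
      where
      kills : killedBy (p ^ suc n ∷ rest) (a ∷ g) (p ^ suc n) ≡ true
      kills = cong₂ _∧_ (isYes-true (p ^ suc n ∣? p ^ suc n * a) (m∣m*n a))
                        (card∣⇒killedBy rest g _ (∣-trans rest∣p (m∣m*n (p ^ n))))
      below : ∀ k → 1 ≤ k → k < p ^ suc n → killedBy (p ^ suc n ∷ rest) (a ∷ g) k ≡ false
      below (suc k) _ k<p^1+n = cong (_∧ killedBy rest g (suc k))
        (isYes-false (p ^ suc n ∣? suc k * a)
          λ ∣ka → <⇒≱ k<p^1+n (∣⇒≤ (^-∣-cancelʳ p-prime p∤a (suc n) (suc k) ∣ka)))

    phiG-^-suc : ∀ n → phiG (p ^ suc n ∷ rest)
                       ≡ phiG (p ^ n ∷ rest) + card rest * (totient (p ^ suc n) * totient (p ^ suc n))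
    phiG-^-suc n = begin
      phiG (p ^ suc n ∷ rest)                           ≡⟨ sum-elements-∷ (p ^ suc n) rest _ ⟩
      ∑< (p * p ^ n) I                                  ≡⟨ cong (λ z → ∑< z I) (*-comm p (p ^ n)) ⟩
      ∑< (p ^ n * p) I                                  ≡⟨ ∑<-* (p ^ n) p I ⟩
      ∑< (p ^ n) (λ b → I (b * p + 0) + ∑< p′ (λ r → I (b * p + suc r)))
        ≡⟨ ∑<-distrib-+ (p ^ n) _ _ ⟩
      ∑< (p ^ n) (λ b → I (b * p + 0)) + ∑< (p ^ n) (λ b → ∑< p′ (λ r → I (b * p + suc r)))
        ≡⟨ cong₂ _+_ multiples-of-p units ⟩
      phiG (p ^ n ∷ rest) + p ^ n * (p′ * (card rest * φ))
        ≡⟨ cong (phiG (p ^ n ∷ rest) +_) (reorder (p ^ n) p′ (card rest) φ) ⟩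
      phiG (p ^ n ∷ rest) + card rest * ((p ^ n * p′) * φ)
        ≡⟨ cong (λ x → phiG (p ^ n ∷ rest) + card rest * (x * φ)) (totient-^-suc n) ⟨
      phiG (p ^ n ∷ rest) + card rest * (φ * φ) ∎
      where
      open ≡-Reasoning
      φ = totient (p ^ suc n)
      I : ℕ → ℕ
      I a = sum (map (λ g → totient (order (p ^ suc n ∷ rest) (a ∷ g))) (elements rest))
      multiples-of-p : ∑< (p ^ n) (λ b → I (b * p + 0)) ≡ phiG (p ^ n ∷ rest)
      multiples-of-p = trans (∑<-cong (p ^ n) (λ b _ → trans (cong I (+-identityʳ (b * p)))
          (cong sum (map-cong (λ g → cong totient (order-∷-* n b g)) (elements rest)))))
        (sym (sum-elements-∷ (p ^ n) rest _))
      units : ∑< (p ^ n) (λ b → ∑< p′ (λ r → I (b * p + suc r))) ≡ p ^ n * (p′ * (card rest * φ))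
      units = trans (∑<-cong (p ^ n) (λ b _ → trans (∑<-cong p′ (λ r r<p′ →
          trans (cong sum (map-cong (λ g → cong totient (order-∷-∤ n _ g (∤-+suc b r r<p′)))
                                    (elements rest)))
                (sum-const-elements rest φ)))
          (∑<-const p′ _)))
        (∑<-const (p ^ n) _)
      reorder : ∀ a b c d → a * (b * (c * d)) ≡ c * ((a * b) * d)
      reorder = solve-∀

  phiG-cyclic : ∀ n → phiG (C (p ^ n)) ≡ ΦC p′ n
  phiG-cyclic zero    = refl
  phiG-cyclic (suc n) = trans (phiG-^-suc [] (1∣ p) n)
    (cong₂ _+_ (phiG-cyclic n) (trans (*-identityˡ _) (cong (λ x → x * x) (totient-^-suc n))))

  phiG-cyclic×p : ∀ n → phiG (C (p ^ n) ×C C p) ≡ ΦC×C p′ n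
  phiG-cyclic×p zero    = trans (phiG-1∷ (p ∷ []) (s≤s z≤n))
    (trans (cong (phiG ∘ C) (sym (*-identityʳ p))) (phiG-cyclic 1))
  phiG-cyclic×p (suc n) = trans (phiG-^-suc (p ∷ []) (∣-reflexive (*-identityʳ p)) n)
    (cong₂ _+_ (phiG-cyclic×p n) (cong₂ _*_ (*-identityʳ p) (cong (λ x → x * x) (totient-^-suc n))))

mainTheorem6 : (p q m t : ℕ) → Prime p → Prime q → p < q → 2 ≤ t → 2 ≤ m →
    phiG (C (p ^ m)) * phiG (C (q ^ (t ∸ 1)) ×C C q)
      < phiG (C (q ^ t)) * phiG (C (p ^ (m ∸ 1)) ×C C p)
mainTheorem6 zero    _    _ _ ()
mainTheorem6 (suc _) zero _ _ _ _ ()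
mainTheorem6 (suc p′) (suc q′) (suc (suc m)) (suc (suc t))
             p-prime q-prime (s≤s p′<q′) (s≤s (s≤s _)) (s≤s (s≤s _)) =
  subst₂ _<_ (sym (cong₂ _*_ (P.phiG-cyclic (suc (suc m))) (Q.phiG-cyclic×p (suc t))))
             (sym (cong₂ _*_ (Q.phiG-cyclic (suc (suc t))) (P.phiG-cyclic×p (suc m))))
             (ΦC-ΦC×C-cross-< (suc m) t 1≤p′ p′<q′)
  where
  module P = PrimePower p-prime
  module Q = PrimePower q-prime
  1≤p′ : 1 ≤ p′
  1≤p′ = s≤s⁻¹ (nonTrivial⇒n>1 (suc p′) {{prime⇒nonTrivial p-prime}})
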